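{- Let $d\ge 1$ and let $M$ be a planar map of girth $d$ and outer degree $d$. Let $v,v'$ be two vertices incident to the outer face which are $m$ edges apart (in one direction or the other) along the outer boundary, $0\le m\le d$. Then every simple path from $v$ to $v'$ containing at least one inner edge (an edge not on the outer boundary) has length at least $\max(m,d-m)$.
   Context: A planar map is an embedding of a connected graph in the sphere without edge crossings, up to continuous deformation, with a distinguished outer face whose degree is the outer degree. The girth is the minimal length of a cycle (simple closed path). In a map of girth $d$ and outer degree $d$ the outer boundary is a cycle of length $d$. -}

module Defs where

open import Data.Nat using (ℕ; zero; suc; _+_; _≤_; _<_; _≤ᵇ_)
open import Data.Fin using (Fin; toℕ)
open import Data.Fin.Permutation using (Permutation′; _⟨$⟩ʳ_)
open import Data.List using (List; []; _∷_; map; filter; length; upTo; allFin)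
open import Data.Bool using (_∧_; true)
open import Data.Empty using (⊥)
open import Data.List.Relation.Unary.AllPairs using (AllPairs)
open import Data.Product using (Σ; _×_; ∃)
open import Data.Sum using (_⊎_)
open import Data.Bool using (Bool; T)
open import Relation.Nullary using (¬_)
open import Relation.Nullary.Decidable using (T?)
open import Relation.Binary.PropositionalEquality using (_≡_; _≢_)
open import Function using (_∘_)

iter : ∀ {A : Set} → (A → A) → ℕ → A → A
iter f zero    x = x
iter f (suc k) x = f (iter f k x)

-- Orbits of a permutation of Fin n have size
-- at most n, so checking the iterates f^k x for k < n suffices.
isOrbitMin : ∀ {n} → (Fin n → Fin n) → Fin n → Bool
isOrbitMin {n} f x = allB (upTo n)
  where
  allB : List ℕ → Bool
  allB []       = true
  allB (k ∷ ks) = (toℕ x ≤ᵇ toℕ (iter f k x)) ∧ allB ks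

numOrbits : ∀ {n} → (Fin n → Fin n) → ℕ
numOrbits {n} f = length (filter (λ x → T? (isOrbitMin f x)) (allFin n))

-- Combinatorial map on darts Fin n: σ = rotation around vertices,
-- α = fixed-point-free involution (edges).  Faces are orbits of φ = σ ∘ α.
record CombMap (n : ℕ) : Set where
  field
    σ : Permutation′ n
    α : Permutation′ n
    α-invol : ∀ x → α ⟨$⟩ʳ (α ⟨$⟩ʳ x) ≡ x
    α-nofix : ∀ x → α ⟨$⟩ʳ x ≢ x

  σf : Fin n → Fin n
  σf x = σ ⟨$⟩ʳ x

  αf : Fin n → Fin n
  αf x = α ⟨$⟩ʳ x

  φ : Fin n → Fin n
  φ = σf ∘ αf

  data Reach : Fin n → Fin n → Set where
    here  : ∀ {x} → Reach x x
    stepσ : ∀ {x y} → Reach (σf x) y → Reach x y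
    stepα : ∀ {x y} → Reach (αf x) y → Reach x y

  Connected : Set
  Connected = ∀ x y → Reach x y

  -- Euler formula V - E + F = 2, i.e. V + F = E + 2 (genus 0)
  Planar : Set
  Planar = numOrbits σf + numOrbits φ ≡ numOrbits αf + 2

  SameV : Fin n → Fin n → Set
  SameV x y = ∃ λ k → iter σf k x ≡ y

  SameE : Fin n → Fin n → Set
  SameE x y = (x ≡ y) ⊎ (αf x ≡ y)

  -- walk: starting at the vertex of dart u, following darts es (dart e goes from
  -- the vertex of e to the vertex of α e), ending at the vertex of dart w
  IsWalk : Fin n → List (Fin n) → Fin n → Set
  IsWalk u []       w = SameV u w
  IsWalk u (e ∷ es) w = SameV u e × IsWalk (αf e) es w

  SimplePath : Fin n → List (Fin n) → Fin n → Set
  SimplePath u es w = IsWalk u es w × AllPairs (λ a b → ¬ SameV a b) (u ∷ map αf es)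

  IsCycle : List (Fin n) → Set
  IsCycle []       = ⊥
  IsCycle (e ∷ es) = IsWalk e (e ∷ es) e
                   × AllPairs (λ a b → ¬ SameV a b) (e ∷ es)
                   × AllPairs (λ a b → ¬ SameE a b) (e ∷ es)

  HasGirth : ℕ → Set
  HasGirth g = (Σ (List (Fin n)) λ c → IsCycle c × length c ≡ g)
             × (∀ c → IsCycle c → g ≤ length c)

  OnOuter : Fin n → Fin n → Set
  OnOuter r x = ∃ λ k → iter φ k r ≡ x

  OuterDegree : Fin n → ℕ → Set
  OuterDegree r d = (iter φ d r ≡ r) × (∀ k → 1 ≤ k → k < d → iter φ k r ≢ r)

  InnerEdge : Fin n → Fin n → Set
  InnerEdge r e = ¬ OnOuter r e × ¬ OnOuter r (αf e)

record PlanarMap (n : ℕ) : Set where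
  field
    map′      : CombMap n
    connected : CombMap.Connected map′
    planar    : CombMap.Planar map′
  open CombMap map′ public

-- Take an inner edge e of the simple path. The path, followed by a walk back along the
-- outer boundary, is a closed walk which uses e and never the reverse dart of e (the
-- path is simple and e is not on the boundary), so erasing its loops leaves a cycle
-- through e. The girth therefore bounds the length of the path plus that of the
-- boundary walk. The two arcs of the boundary between v and v' have lengths d - m and
-- m, giving m ≤ |es| and d - m ≤ |es|.
module Submission where

open import Defs
open import Data.Nat using (ℕ; zero; suc; _+_; _*_; _≤_; _∸_; _⊔_; z≤n; s≤s)
open import Data.Nat.Properties
  using (+-suc; +-identityʳ; +-comm; +-assoc; *-suc; n<1+n; n≤1+n; m≤n⇒m≤1+n; ≤-refl; ≤-trans;
         m∸n+n≡m; m+[n∸m]≡n; m∸[m∸n]≡n; m≤n+o⇒m∸n≤o; ⊔-lub; module ≤-Reasoning)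
open import Data.Nat.DivMod using (_%_; _/_; m≡m%n+[m/n]*n; m%n<n)
open import Data.Nat.Tactic.RingSolver using (solve-∀)
open import Data.Fin using (Fin; toℕ; fromℕ<) renaming (_≟_ to _≟ᶠ_)
open import Data.Fin.Properties using (pigeonhole; any?; toℕ-fromℕ<)
open import Data.Fin.Permutation using (Permutation′; _⟨$⟩ʳ_; _⟨$⟩ˡ_; inverseˡ)
open import Data.List using (List; []; _∷_; _++_; length)
open import Data.List.Properties using (length-++)
open import Data.List.Relation.Unary.Any using (Any; here; there)
open import Data.List.Relation.Unary.All as All using (All; []; _∷_)
open import Data.List.Relation.Unary.All.Properties using (++⁺; ++⁻; map⁻; All¬⇒¬Any)
open import Data.List.Relation.Unary.AllPairs using (AllPairs; []; _∷_)
open import Data.List.Membership.Propositional using (_∈_; find)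
open import Data.List.Membership.Propositional.Properties using (∈-∃++)
open import Data.Product using (∃; _×_; _,_; proj₁; map₁)
open import Data.Sum using (_⊎_; inj₁; inj₂)
open import Relation.Nullary using (¬_; Dec; yes; no)
open import Relation.Binary.PropositionalEquality

iter-+ : ∀ {A : Set} (f : A → A) a b x → iter f (a + b) x ≡ iter f a (iter f b x)
iter-+ f zero    b x = refl
iter-+ f (suc a) b x = cong f (iter-+ f a b x)

iter-*-period : ∀ {A : Set} (f : A → A) {x} p t → iter f p x ≡ x → iter f (t * p) x ≡ x
iter-*-period f     p zero    fᵖx≡x = refl
iter-*-period f {x} p (suc t) fᵖx≡x =
  trans (iter-+ f p (t * p) x) (trans (cong (iter f p) (iter-*-period f p t fᵖx≡x)) fᵖx≡x)

iter-%-period : ∀ {A : Set} (f : A → A) {x} p k → iter f (suc p) x ≡ x →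
                iter f (k % suc p) x ≡ iter f k x
iter-%-period f {x} p k period = begin
  iter f (k % suc p) x                  ≡⟨ cong (iter f (k % suc p)) (iter-*-period f (suc p) q period) ⟨
  iter f (k % suc p) (iter f (q * suc p) x) ≡⟨ iter-+ f (k % suc p) (q * suc p) x ⟨
  iter f (k % suc p + q * suc p) x      ≡⟨ cong (λ t → iter f t x) (m≡m%n+[m/n]*n k (suc p)) ⟨
  iter f k x                            ∎
  where
  open ≡-Reasoning
  q : ℕ
  q = k / suc p

module OrbitRelation {n} (π : Permutation′ n) where

  private
    f : Fin n → Fin n
    f x = π ⟨$⟩ʳ x

  SameOrbit : Fin n → Fin n → Set
  SameOrbit x y = ∃ λ k → iter f k x ≡ y

  iter-injective : ∀ k {x y} → iter f k x ≡ iter f k y → x ≡ y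
  iter-injective zero    eq = eq
  iter-injective (suc k) eq =
    iter-injective k (trans (sym (inverseˡ π)) (trans (cong (π ⟨$⟩ˡ_) eq) (inverseˡ π)))

  -- Two of the n + 1 iterates f⁰ x, …, fⁿ x coincide, and f is injective.
  iter-periodic : ∀ x → ∃ λ p → iter f (suc p) x ≡ x
  iter-periodic x
    with i , j , i<j , fⁱx≡fʲx ← pigeonhole (n<1+n n) (λ (i : Fin (suc n)) → iter f (toℕ i) x)
    = p , iter-injective (toℕ i) fⁱ⁺ᵖ⁺¹x≡fⁱx
    where
    p : ℕ
    p = toℕ j ∸ suc (toℕ i)
    fⁱ⁺ᵖ⁺¹x≡fⁱx : iter f (toℕ i) (iter f (suc p) x) ≡ iter f (toℕ i) x
    fⁱ⁺ᵖ⁺¹x≡fⁱx = begin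
      iter f (toℕ i) (iter f (suc p) x) ≡⟨ iter-+ f (toℕ i) (suc p) x ⟨
      iter f (toℕ i + suc p) x           ≡⟨ cong (λ k → iter f k x) (+-comm (toℕ i) (suc p)) ⟩
      iter f (suc p + toℕ i) x           ≡⟨ cong (λ k → iter f k x) (+-suc p (toℕ i)) ⟨
      iter f (p + suc (toℕ i)) x         ≡⟨ cong (λ k → iter f k x) (m∸n+n≡m i<j) ⟩
      iter f (toℕ j) x                   ≡⟨ fⁱx≡fʲx ⟨
      iter f (toℕ i) x                   ∎
      where open ≡-Reasoning

  orbit-refl : ∀ {x} → SameOrbit x x
  orbit-refl = 0 , refl

  orbit-trans : ∀ {x y z} → SameOrbit x y → SameOrbit y z → SameOrbit x z
  orbit-trans {x} (k , refl) (l , refl) = l + k , iter-+ f l k x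

  -- Going backwards k steps is going forwards k·p steps, p + 1 being a period.
  orbit-sym : ∀ {x y} → SameOrbit x y → SameOrbit y x
  orbit-sym {x} (k , refl) with p , period ← iter-periodic x =
    k * p , trans (sym (iter-+ f (k * p) k x))
                  (trans (cong (λ t → iter f t x) k*p+k≡k*[1+p]) (iter-*-period f (suc p) k period))
    where
    k*p+k≡k*[1+p] : k * p + k ≡ k * suc p
    k*p+k≡k*[1+p] = trans (+-comm (k * p) k) (sym (*-suc k p))

  orbit? : ∀ x y → Dec (SameOrbit x y)
  orbit? x y with p , period ← iter-periodic x
              with any? (λ (k : Fin (suc p)) → iter f (toℕ k) x ≟ᶠ y)
  ... | yes (k , fᵏx≡y) = yes (toℕ k , fᵏx≡y)
  ... | no ∄k = no λ (k , fᵏx≡y) → ∄k (fromℕ< (m%n<n k (suc p)) ,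
          trans (cong (λ t → iter f t x) (toℕ-fromℕ< (m%n<n k (suc p))))
                (trans (iter-%-period f p k period) fᵏx≡y))

module Walks {n} (M : CombMap n) where
  open CombMap M
  open OrbitRelation σ

  walk-from : ∀ {a b c} ps → SameV a b → IsWalk b ps c → IsWalk a ps c
  walk-from []       a∼b b∼c       = orbit-trans a∼b b∼c
  walk-from (p ∷ ps) a∼b (b∼p , w) = orbit-trans a∼b b∼p , w

  walk-++ : ∀ {a b c} ps qs → IsWalk a ps b → IsWalk b qs c → IsWalk a (ps ++ qs) c
  walk-++ []       qs a∼b      w′ = walk-from qs a∼b w′
  walk-++ (p ∷ ps) qs (a∼p , w) w′ = a∼p , walk-++ ps qs w w′

  walk-split : ∀ {a c} ps e qs → IsWalk a (ps ++ e ∷ qs) c → IsWalk a ps e × IsWalk (αf e) qs c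
  walk-split []       e qs w         = w
  walk-split (p ∷ ps) e qs (a∼p , w) = map₁ (a∼p ,_) (walk-split ps e qs w)

  walk-step : ∀ {c b q} ps → IsWalk c ps b → q ∈ ps → Any (SameV (αf q)) ps ⊎ SameV (αf q) b
  walk-step (p ∷ [])      (_ , αp∼b)        (here refl)  = inj₂ αp∼b
  walk-step (p ∷ p′ ∷ ps) (_ , (αp∼p′ , _)) (here refl)  = inj₁ (there (here αp∼p′))
  walk-step (p ∷ ps)      (_ , w)           (there q∈ps) with walk-step ps w q∈ps
  ... | inj₁ later = inj₁ (there later)
  ... | inj₂ end   = inj₂ end

  -- The vertices of the walk ps ending at b, namely the start vertices of its darts and b.
  DistinctVertices : Fin n → List (Fin n) → Set
  DistinctVertices b ps = AllPairs (λ u v → ¬ SameV u v) (b ∷ ps)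

  distinctVertices-tail : ∀ {b p ps} → DistinctVertices b (p ∷ ps) → DistinctVertices b ps
  distinctVertices-tail ((_ ∷ b≁ps) ∷ (_ ∷ ps-distinct)) = b≁ps ∷ ps-distinct

  distinctVertices⇒distinctEdges : ∀ {a b} ps → IsWalk a ps b → DistinctVertices b ps →
                                   AllPairs (λ u v → ¬ SameE u v) ps
  distinctVertices⇒distinctEdges []       _       _ = []
  distinctVertices⇒distinctEdges {b = b} (p ∷ ps) (_ , w) dist@((b≁p ∷ _) ∷ (p≁ps ∷ _)) =
    All.tabulate p≁edge ∷ distinctVertices⇒distinctEdges ps w (distinctVertices-tail dist)
    where
    p≁edge : ∀ {q} → q ∈ ps → ¬ SameE p q
    p≁edge q∈ps (inj₁ refl) = All.lookup p≁ps q∈ps orbit-refl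
    p≁edge q∈ps (inj₂ refl) with walk-step ps w q∈ps
    ... | inj₁ later = All¬⇒¬Any p≁ps (subst (λ z → Any (SameV z) ps) (α-invol p) later)
    ... | inj₂ end   = b≁p (orbit-sym (subst (λ z → SameV z b) (α-invol p) end))

  record LoopFreeWalk (P : Fin n → Set) (a b : Fin n) (ℓ : ℕ) : Set where
    constructor loopFree
    field
      darts    : List (Fin n)
      walk     : IsWalk a darts b
      distinct : DistinctVertices b darts
      all-P    : All P darts
      length≤  : length darts ≤ ℓ

  loopFree-from : ∀ {P a a′ b ℓ} → SameV a a′ →
                  LoopFreeWalk P a′ b ℓ → LoopFreeWalk P a b ℓ
  loopFree-from a∼a′ (loopFree ps w dist Pps len) = loopFree ps (walk-from ps a∼a′ w) dist Pps len

  loopFree-weaken : ∀ {P a b ℓ ℓ′} → ℓ ≤ ℓ′ → LoopFreeWalk P a b ℓ → LoopFreeWalk P a b ℓ′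
  loopFree-weaken ℓ≤ℓ′ (loopFree ps w dist Pps len) =
    loopFree ps w dist Pps (≤-trans len ℓ≤ℓ′)

  loopFree-suffix : ∀ {P c b} q ps → IsWalk c ps b → DistinctVertices b ps → All P ps →
                    All (λ p → ¬ SameV q p) ps ⊎ LoopFreeWalk P q b (length ps)
  loopFree-suffix q []       _         _    _          = inj₁ []
  loopFree-suffix q (p ∷ ps) (_ , w) dist (Pp ∷ Pps) with orbit? q p
  ... | yes q∼p = inj₂ (loopFree (p ∷ ps) (q∼p , w) dist (Pp ∷ Pps) ≤-refl)
  ... | no  q≁p with loopFree-suffix q ps w (distinctVertices-tail dist) Pps
  ...   | inj₁ q≁ps = inj₁ (q≁p ∷ q≁ps)
  ...   | inj₂ lw   = inj₂ (loopFree-weaken (n≤1+n _) lw)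

  -- Erase the loops of the tail first; then the first vertex is either new, or the walk
  -- restarts from its later visit.
  loopErase : ∀ {P a b} qs → IsWalk a qs b → All P qs → LoopFreeWalk P a b (length qs)
  loopErase []       a∼b         []         = loopFree [] a∼b ([] ∷ []) [] z≤n
  loopErase {b = b} (q ∷ qs) (a∼q , w) (Pq ∷ Pqs)
    with loopFree ps w′ dist Pps len ← loopErase qs w Pqs
    with orbit? q b
  ... | yes q∼b = loopFree [] (orbit-trans a∼q q∼b) ([] ∷ []) [] z≤n
  ... | no  q≁b with loopFree-suffix q ps w′ dist Pps
  ...   | inj₁ q≁ps = loopFree (q ∷ ps) (a∼q , w′) (extend dist) (Pq ∷ Pps) (s≤s len)
    where
    extend : DistinctVertices b ps → DistinctVertices b (q ∷ ps)
    extend (b≁ps ∷ ps-distinct) =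
      ((λ b∼q → q≁b (orbit-sym b∼q)) ∷ b≁ps) ∷ (q≁ps ∷ ps-distinct)
  ...   | inj₂ lw   = loopFree-from a∼q (loopFree-weaken (m≤n⇒m≤1+n len) lw)

  girth≤closedWalk : ∀ {g} → (∀ c → IsCycle c → g ≤ length c) →
                     ∀ {e} qs → IsWalk (αf e) qs e → All (αf e ≢_) qs → g ≤ suc (length qs)
  girth≤closedWalk girth {e} qs w αe∉qs
    with loopFree ps w′ dist@(e≁ps ∷ _) αe∉ps len ← loopErase qs w αe∉qs
    = ≤-trans (girth (e ∷ ps) cycle) (s≤s len)
    where
    e≁edge : ∀ {p} → ¬ SameV e p × αf e ≢ p → ¬ SameE e p
    e≁edge (e≁p , _)   (inj₁ refl) = e≁p orbit-refl
    e≁edge (_ , αe≢p)  (inj₂ αe≡p) = αe≢p αe≡p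
    cycle : IsCycle (e ∷ ps)
    cycle = (orbit-refl , w′) , dist ,
            (All.zipWith e≁edge (e≁ps , αe∉ps) ∷ distinctVertices⇒distinctEdges ps w′ dist)

  twin-sym : ∀ {x y} → αf x ≢ y → αf y ≢ x
  twin-sym {x} αx≢y αy≡x = αx≢y (trans (cong αf (sym αy≡x)) (α-invol _))

  simplePath-tail : ∀ {u x xs w} → SimplePath u (x ∷ xs) w → SimplePath (αf x) xs w
  simplePath-tail ((_ , w) , (_ ∷ distinct)) = w , distinct

  -- The reverse of the first dart would end at the start vertex u, which is not revisited.
  simplePath-head-twin∉ : ∀ {u x xs w} → SimplePath u (x ∷ xs) w → All (αf x ≢_) xs
  simplePath-head-twin∉ {u} {x} ((u∼x , _) , ((_ ∷ u≁ends) ∷ _)) = All.map twin∉ (map⁻ u≁ends)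
    where
    twin∉ : ∀ {y} → ¬ SameV u (αf y) → αf x ≢ y
    twin∉ u≁αy αx≡y =
      u≁αy (subst (SameV u) (sym (trans (cong αf (sym αx≡y)) (α-invol x))) u∼x)

  simplePath-twin∉ : ∀ {u w e} es → SimplePath u es w → e ∈ es → All (αf e ≢_) es
  simplePath-twin∉ (x ∷ xs) path (here refl)  = α-nofix x ∷ simplePath-head-twin∉ path
  simplePath-twin∉ (x ∷ xs) path (there e∈xs) =
    twin-sym (All.lookup (simplePath-head-twin∉ path) e∈xs) ∷
    simplePath-twin∉ xs (simplePath-tail path) e∈xs

  girth≤simplePath+closingWalk : ∀ {g u w e es A} → (∀ c → IsCycle c → g ≤ length c) →
    SimplePath u es w → e ∈ es → IsWalk w A u → All (αf e ≢_) A → g ≤ length A + length es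
  girth≤simplePath+closingWalk {g} {e = e} {es} {A} girth path e∈es back αe∉A
    with αe∉es ← simplePath-twin∉ es path e∈es
    with pre , post , refl ← ∈-∃++ e∈es
    with αe∉pre , _ ∷ αe∉post ← ++⁻ pre αe∉es
    with to-e , from-e ← walk-split pre e post (proj₁ path) = begin
      g                                ≤⟨ girth≤closedWalk girth (post ++ A ++ pre)
                                            (walk-++ post _ from-e (walk-++ A pre back to-e))
                                            (++⁺ αe∉post (++⁺ αe∉A αe∉pre)) ⟩
      suc (length (post ++ A ++ pre))  ≡⟨ cong suc (trans (length-++ post)
                                                              (cong (length post +_) (length-++ A))) ⟩
      suc (length post + (length A + length pre))
                                       ≡⟨ rearrange (length pre) (length post) (length A) ⟩
      length A + (length pre + suc (length post))
                                       ≡⟨ cong (length A +_) (length-++ pre) ⟨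
      length A + length (pre ++ e ∷ post) ∎
    where
    open ≤-Reasoning
    rearrange : ∀ p q a → suc (q + (a + p)) ≡ a + (p + suc q)
    rearrange = solve-∀

module Boundary {n} (M : CombMap n) (r : Fin n) where
  open CombMap M
  open OrbitRelation σ
  open Walks M

  BoundaryDart : Fin n → Set
  BoundaryDart y = OnOuter r y ⊎ OnOuter r (αf y)

  innerEdge-twin≢boundaryDart : ∀ {e y} → InnerEdge r e → BoundaryDart y → αf e ≢ y
  innerEdge-twin≢boundaryDart (_ , αe∉outer) (inj₁ (k , φᵏr≡y))  αe≡y =
    αe∉outer (k , trans φᵏr≡y (sym αe≡y))
  innerEdge-twin≢boundaryDart (e∉outer , _) (inj₂ (k , φᵏr≡αy)) αe≡y =
    e∉outer (k , trans φᵏr≡αy (trans (cong αf (sym αe≡y)) (α-invol _)))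

  boundaryArc : ℕ → ℕ → List (Fin n)
  boundaryArc j zero    = []
  boundaryArc j (suc k) = iter φ j r ∷ boundaryArc (suc j) k

  reverseBoundaryArc : ℕ → ℕ → List (Fin n)
  reverseBoundaryArc j zero    = []
  reverseBoundaryArc j (suc k) = αf (iter φ (j + k) r) ∷ reverseBoundaryArc j k

  boundaryArc-walk : ∀ j k → IsWalk (iter φ j r) (boundaryArc j k) (iter φ (j + k) r)
  boundaryArc-walk j zero    =
    subst (λ t → SameV (iter φ j r) (iter φ t r)) (sym (+-identityʳ j)) orbit-refl
  boundaryArc-walk j (suc k) =
    orbit-refl , walk-from (boundaryArc (suc j) k) (1 , refl)
                   (subst (λ t → IsWalk (iter φ (suc j) r) (boundaryArc (suc j) k) (iter φ t r))
                          (sym (+-suc j k)) (boundaryArc-walk (suc j) k))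

  boundaryArc-wrap : ∀ {d k l} → iter φ d r ≡ r → ∀ j → k + l ≡ d →
                     IsWalk (iter φ (j + k) r) (boundaryArc (j + k) l) (iter φ j r)
  boundaryArc-wrap {d} {k} {l} φᵈr≡r j k+l≡d =
    subst (IsWalk _ (boundaryArc (j + k) l)) φʲ⁺ᵏ⁺ˡr≡φʲr (boundaryArc-walk (j + k) l)
    where
    φʲ⁺ᵏ⁺ˡr≡φʲr : iter φ (j + k + l) r ≡ iter φ j r
    φʲ⁺ᵏ⁺ˡr≡φʲr = begin
      iter φ (j + k + l) r  ≡⟨ cong (λ t → iter φ t r) (trans (+-assoc j k l) (cong (j +_) k+l≡d)) ⟩
      iter φ (j + d) r      ≡⟨ iter-+ φ j d r ⟩
      iter φ j (iter φ d r) ≡⟨ cong (iter φ j) φᵈr≡r ⟩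
      iter φ j r            ∎
      where open ≡-Reasoning

  reverseBoundaryArc-walk : ∀ j k → IsWalk (iter φ (j + k) r) (reverseBoundaryArc j k) (iter φ j r)
  reverseBoundaryArc-walk j zero    =
    subst (λ t → SameV (iter φ t r) (iter φ j r)) (sym (+-identityʳ j)) orbit-refl
  reverseBoundaryArc-walk j (suc k) =
    subst (λ t → SameV (iter φ t r) (αf (iter φ (j + k) r))) (sym (+-suc j k)) (orbit-sym (1 , refl)) ,
    subst (λ x → IsWalk x (reverseBoundaryArc j k) (iter φ j r)) (sym (α-invol _))
          (reverseBoundaryArc-walk j k)

  boundaryArc-length : ∀ j k → length (boundaryArc j k) ≡ k
  boundaryArc-length j zero    = refl
  boundaryArc-length j (suc k) = cong suc (boundaryArc-length (suc j) k)

  reverseBoundaryArc-length : ∀ j k → length (reverseBoundaryArc j k) ≡ k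
  reverseBoundaryArc-length j zero    = refl
  reverseBoundaryArc-length j (suc k) = cong suc (reverseBoundaryArc-length j k)

  boundaryArc-boundary : ∀ j k → All BoundaryDart (boundaryArc j k)
  boundaryArc-boundary j zero    = []
  boundaryArc-boundary j (suc k) = inj₁ (j , refl) ∷ boundaryArc-boundary (suc j) k

  reverseBoundaryArc-boundary : ∀ j k → All BoundaryDart (reverseBoundaryArc j k)
  reverseBoundaryArc-boundary j zero    = []
  reverseBoundaryArc-boundary j (suc k) =
    inj₂ (j + k , sym (α-invol _)) ∷ reverseBoundaryArc-boundary j k

mainTheorem2 : ∀ {n} (M : PlanarMap n) (r : Fin n) (d : ℕ) → 1 ≤ d
    → PlanarMap.HasGirth M d → PlanarMap.OuterDegree M r d
    → (i m : ℕ) → m ≤ d → (es : List (Fin n))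
    → PlanarMap.SimplePath M (iter (PlanarMap.φ M) i r) es (iter (PlanarMap.φ M) (i + m) r)
    → Any (PlanarMap.InnerEdge M r) es
    → m ⊔ (d ∸ m) ≤ length es
mainTheorem2 M r d _ (_ , girth) (φᵈr≡r , _) i m m≤d es path inner
  with e , e∈es , e-inner ← find inner = ⊔-lub m≤|es| d∸m≤|es|
  where
  open PlanarMap M
  open Walks map′
  open Boundary map′ r

  d≤arc+|es| : ∀ {A} ℓ → IsWalk (iter φ (i + m) r) A (iter φ i r) → All BoundaryDart A →
               length A ≡ ℓ → d ≤ ℓ + length es
  d≤arc+|es| ℓ back on-boundary refl = girth≤simplePath+closingWalk girth path e∈es back
    (All.map (innerEdge-twin≢boundaryDart e-inner) on-boundary)

  m≤|es| : m ≤ length es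
  m≤|es| = subst (_≤ length es) (m∸[m∸n]≡n m≤d) (m≤n+o⇒m∸n≤o d (d ∸ m)
    (d≤arc+|es| (d ∸ m) (boundaryArc-wrap φᵈr≡r i (m+[n∸m]≡n m≤d))
      (boundaryArc-boundary (i + m) (d ∸ m)) (boundaryArc-length (i + m) (d ∸ m))))

  d∸m≤|es| : d ∸ m ≤ length es
  d∸m≤|es| = m≤n+o⇒m∸n≤o d m
    (d≤arc+|es| m (reverseBoundaryArc-walk i m)
      (reverseBoundaryArc-boundary i m) (reverseBoundaryArc-length i m))
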